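{- For every (untyped) $\lambda\mu$T-term $t$: if $t\in\mathrm{SN}_A$, then $t\in\mathrm{SN}_{AB}$.
   Context: $\lambda\mu$T raw terms/commands: $t,r,s ::= x\mid\lambda x.r\mid ts\mid\mu\alpha.c\mid0\mid\mathsf S\,t\mid\mathsf{nrec}\ r\ s\ t$, $c::=[\alpha]t$ ($x$ $\lambda$-variables, $\alpha$ $\mu$-variables); $\mathrm{FCV}$: free $\mu$-variables; $\overline n:=\mathsf S^n0$. Contexts $E ::= \Box \mid E\,t \mid \mathsf S\,E \mid \mathsf{nrec}\ r\ s\ E$; structural substitution $t[\alpha:=\beta E]$ replaces recursively each subcommand $[\alpha]q$ by $[\beta]E[q[\alpha:=\beta E]]$ (capture-avoiding). $\to_A$ is the compatible closure (on terms and commands) of: $(\lambda x.t)r \to t[x:=r]$; $\mathsf S(\mu\alpha.c)\to \mu\alpha.c[\alpha:=\alpha(\mathsf S\Box)]$; $(\mu\alpha.c)s\to\mu\alpha.c[\alpha:=\alpha(\Box s)]$; $\mathsf{nrec}\ r\ s\ 0\to r$; $\mathsf{nrec}\ r\ s\ (\mathsf S\,\overline n)\to s\ \overline n\ (\mathsf{nrec}\ r\ s\ \overline n)$; $\mathsf{nrec}\ r\ s\ (\mu\alpha.c)\to\mu\alpha.c[\alpha:=\alpha(\mathsf{nrec}\ r\ s\ \Box)]$. $\to_B$ is the compatible closure of $\mu\alpha.[\alpha]t\to t$ if $\alpha\notin\mathrm{FCV}(t)$ and $[\alpha]\mu\beta.c\to c[\beta:=\alpha\,\Box]$. $\to_{AB}:=\to_A\cup\to_B$.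 For a relation $\to_X$, $\mathrm{SN}_X$ is the inductively defined set: $t\in\mathrm{SN}_X$ if every $t'$ with $t\to_X t'$ lies in $\mathrm{SN}_X$. -}

module Defs where

-- Untyped λμT syntax with de Bruijn indices (two separate namespaces:
-- λ-variables and μ-variables), reductions →A, →B, →AB, and SN_X.

open import Data.Nat using (ℕ; zero; suc)
open import Data.Nat using (_≡ᵇ_)
open import Data.Bool using (if_then_else_)
open import Data.Sum using (_⊎_)

mutual
  data Tm : Set where
    var  : ℕ → Tm
    lam  : Tm → Tm
    app  : Tm → Tm → Tm
    mu   : Cmd → Tm               -- μα.c   (binds μ-index 0 in c)
    ze   : Tm
    S    : Tm → Tm
    nrec : Tm → Tm → Tm → Tm

  data Cmd : Set where
    named : ℕ → Tm → Cmd

num : ℕ → Tm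
num zero    = ze
num (suc n) = S (num n)

ext : (ℕ → ℕ) → ℕ → ℕ
ext ρ zero    = zero
ext ρ (suc n) = suc (ρ n)

mutual
  renλ : (ℕ → ℕ) → Tm → Tm
  renλ ρ (var x)      = var (ρ x)
  renλ ρ (lam t)      = lam (renλ (ext ρ) t)
  renλ ρ (app t s)    = app (renλ ρ t) (renλ ρ s)
  renλ ρ (mu c)       = mu (renλc ρ c)
  renλ ρ ze           = ze
  renλ ρ (S t)        = S (renλ ρ t)
  renλ ρ (nrec r s t) = nrec (renλ ρ r) (renλ ρ s) (renλ ρ t)

  renλc : (ℕ → ℕ) → Cmd → Cmd
  renλc ρ (named α t) = named α (renλ ρ t)

mutual
  renμ : (ℕ → ℕ) → Tm → Tm
  renμ ρ (var x)      = var x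
  renμ ρ (lam t)      = lam (renμ ρ t)
  renμ ρ (app t s)    = app (renμ ρ t) (renμ ρ s)
  renμ ρ (mu c)       = mu (renμc (ext ρ) c)
  renμ ρ ze           = ze
  renμ ρ (S t)        = S (renμ ρ t)
  renμ ρ (nrec r s t) = nrec (renμ ρ r) (renμ ρ s) (renμ ρ t)

  renμc : (ℕ → ℕ) → Cmd → Cmd
  renμc ρ (named α t) = named (ρ α) (renμ ρ t)

-- weakening of μ-variables (used for the side condition α ∉ FCV(t))
wkμ : Tm → Tm
wkμ = renμ suc

extsλ : (ℕ → Tm) → ℕ → Tm
extsλ σ zero    = var zero
extsλ σ (suc n) = renλ suc (σ n)

mutual
  sub : (ℕ → Tm) → Tm → Tm
  sub σ (var x)      = σ x
  sub σ (lam t)      = lam (sub (extsλ σ) t)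
  sub σ (app t s)    = app (sub σ t) (sub σ s)
  sub σ (mu c)       = mu (subc (λ n → renμ suc (σ n)) c)
  sub σ ze           = ze
  sub σ (S t)        = S (sub σ t)
  sub σ (nrec r s t) = nrec (sub σ r) (sub σ s) (sub σ t)

  subc : (ℕ → Tm) → Cmd → Cmd
  subc σ (named α t) = named α (sub σ t)

sub1 : Tm → ℕ → Tm
sub1 r zero    = r
sub1 r (suc n) = var n

_[0:=_] : Tm → Tm → Tm
t [0:= r ] = sub (sub1 r) t

data Ctx : Set where
  hole  : Ctx
  appC  : Ctx → Tm → Ctx
  SC    : Ctx → Ctx
  nrecC : Tm → Tm → Ctx → Ctx

plug : Ctx → Tm → Tm
plug hole          q = q
plug (appC E t)    q = app (plug E q) t
plug (SC E)        q = S (plug E q)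
plug (nrecC r s E) q = nrec r s (plug E q)

renλE : (ℕ → ℕ) → Ctx → Ctx
renλE ρ hole          = hole
renλE ρ (appC E t)    = appC (renλE ρ E) (renλ ρ t)
renλE ρ (SC E)        = SC (renλE ρ E)
renλE ρ (nrecC r s E) = nrecC (renλ ρ r) (renλ ρ s) (renλE ρ E)

renμE : (ℕ → ℕ) → Ctx → Ctx
renμE ρ hole          = hole
renμE ρ (appC E t)    = appC (renμE ρ E) (renμ ρ t)
renμE ρ (SC E)        = SC (renμE ρ E)
renμE ρ (nrecC r s E) = nrecC (renμ ρ r) (renμ ρ s) (renμE ρ E)

mutual
  ss : ℕ → Ctx → Tm → Tm
  ss α E (var x)      = var x
  ss α E (lam t)      = lam (ss α (renλE suc E) t)
  ss α E (app t s)    = app (ss α E t) (ss α E s)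
  ss α E (mu c)       = mu (ssc (suc α) (renμE suc E) c)
  ss α E ze           = ze
  ss α E (S t)        = S (ss α E t)
  ss α E (nrec r s t) = nrec (ss α E r) (ss α E s) (ss α E t)

  ssc : ℕ → Ctx → Cmd → Cmd
  ssc α E (named γ q) =
    if γ ≡ᵇ α then named γ (plug E (ss α E q)) else named γ (ss α E q)

-- c[β:=α□] where β is the μ-variable bound by the enclosing μ (index 0):
-- rename 0 to α and lower all other free μ-indices by one
contract : ℕ → ℕ → ℕ
contract α zero    = α
contract α (suc n) = n

data RootA : Tm → Tm → Set where
  β     : ∀ t r → RootA (app (lam t) r) (t [0:= r ])
  μS    : ∀ c → RootA (S (mu c)) (mu (ssc zero (SC hole) c))
  μapp  : ∀ c s → RootA (app (mu c) s) (mu (ssc zero (appC hole (wkμ s)) c))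
  nrec0 : ∀ r s → RootA (nrec r s ze) r
  nrecS : ∀ r s n → RootA (nrec r s (S (num n)))
                          (app (app s (num n)) (nrec r s (num n)))
  nrecμ : ∀ r s c → RootA (nrec r s (mu c))
                          (mu (ssc zero (nrecC (wkμ r) (wkμ s) hole) c))

data RootAc : Cmd → Cmd → Set where

data RootB : Tm → Tm → Set where
  -- μα.[α]t → t  if α ∉ FCV(t): in de Bruijn form, the body is the
  -- μ-weakening of t (exactly the terms not mentioning the bound index 0)
  μη : ∀ t → RootB (mu (named zero (wkμ t))) t

data RootBc : Cmd → Cmd → Set where
  μβ : ∀ α c → RootBc (named α (mu c)) (renμc (contract α) c)

mutual
  data Compat (R : Tm → Tm → Set) (Rc : Cmd → Cmd → Set) : Tm → Tm → Set where
    root  : ∀ {t t'} → R t t' → Compat R Rc t t'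
    lamξ  : ∀ {t t'} → Compat R Rc t t' → Compat R Rc (lam t) (lam t')
    appξ₁ : ∀ {t t' s} → Compat R Rc t t' → Compat R Rc (app t s) (app t' s)
    appξ₂ : ∀ {t s s'} → Compat R Rc s s' → Compat R Rc (app t s) (app t s')
    muξ   : ∀ {c c'} → CompatC R Rc c c' → Compat R Rc (mu c) (mu c')
    Sξ    : ∀ {t t'} → Compat R Rc t t' → Compat R Rc (S t) (S t')
    nrecξ₁ : ∀ {r r' s t} → Compat R Rc r r' → Compat R Rc (nrec r s t) (nrec r' s t)
    nrecξ₂ : ∀ {r s s' t} → Compat R Rc s s' → Compat R Rc (nrec r s t) (nrec r s' t)
    nrecξ₃ : ∀ {r s t t'} → Compat R Rc t t' → Compat R Rc (nrec r s t) (nrec r s t')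

  data CompatC (R : Tm → Tm → Set) (Rc : Cmd → Cmd → Set) : Cmd → Cmd → Set where
    rootc  : ∀ {c c'} → Rc c c' → CompatC R Rc c c'
    namedξ : ∀ {α t t'} → Compat R Rc t t' → CompatC R Rc (named α t) (named α t')

_∪_ : {A : Set} → (A → A → Set) → (A → A → Set) → A → A → Set
(R ∪ R') x y = R x y ⊎ R' x y

_→A_ : Tm → Tm → Set
_→A_ = Compat RootA RootAc

_→B_ : Tm → Tm → Set
_→B_ = Compat RootB RootBc

_→AB_ : Tm → Tm → Set
_→AB_ = Compat (RootA ∪ RootB) (RootAc ∪ RootBc)

data SN (R : Tm → Tm → Set) (t : Tm) : Set where
  sn : (∀ t' → R t t' → SN R t') → SN R t

module Submission where

-- The proof is by postponement.  Two facts about B suffice: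
--   (1) B terminates on its own, because every B-step strictly decreases
--       the size of a term;
--   (2) a B-step followed by an A-step can be replaced by an A-step
--       followed by a (possibly empty) AB-sequence:
--           t →B t' →A u   implies   t →A t₂ →AB* u  for some t₂.
-- An abstract argument (module Postponement) then shows SN_A ⊆ SN_AB by
-- a nested induction on SN_A and SN_B.

open import Defs
open import Data.Nat using (ℕ; zero; suc; _+_; _<_; s≤s; _≡ᵇ_)
open import Data.Nat.Properties using (n≤1+n; +-monoˡ-<; +-monoʳ-<)
open import Data.Nat.Induction using (<-wellFounded)
open import Induction.WellFounded using (Acc; acc)
open import Data.Bool using (true; false; if_then_else_)
open import Data.Product using (Σ; _×_; _,_)
open import Data.Sum using (_⊎_; inj₁; inj₂; [_,_]) renaming (map to ⊎-map)
open import Relation.Binary.PropositionalEquality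
  using (_≡_; refl; sym; trans; cong; cong₂; subst; subst₂)
open import Relation.Binary.Construct.Closure.ReflexiveTransitive
  using (Star; ε; _◅_; _◅◅_; gmap)

cong₃ : ∀ {A B C D : Set} (f : A → B → C → D) {a a' b b' c c'} →
        a ≡ a' → b ≡ b' → c ≡ c' → f a b c ≡ f a' b' c'
cong₃ f refl refl refl = refl

ext-ext : ∀ {ρ ρ' : ℕ → ℕ} → (∀ x → ρ x ≡ ρ' x) → ∀ x → ext ρ x ≡ ext ρ' x
ext-ext h zero    = refl
ext-ext h (suc x) = cong suc (h x)

ext-comp : ∀ (ρ ρ' : ℕ → ℕ) x → ext ρ (ext ρ' x) ≡ ext (λ y → ρ (ρ' y)) x
ext-comp ρ ρ' zero    = refl
ext-comp ρ ρ' (suc x) = refl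

ext-id : ∀ {ρ : ℕ → ℕ} → (∀ x → ρ x ≡ x) → ∀ x → ext ρ x ≡ x
ext-id h zero    = refl
ext-id h (suc x) = cong suc (h x)

mutual
  renμ-ext : ∀ {ρ ρ'} → (∀ x → ρ x ≡ ρ' x) → ∀ t → renμ ρ t ≡ renμ ρ' t
  renμ-ext h (var x)      = refl
  renμ-ext h (lam t)      = cong lam (renμ-ext h t)
  renμ-ext h (app t s)    = cong₂ app (renμ-ext h t) (renμ-ext h s)
  renμ-ext h (mu c)       = cong mu (renμc-ext (ext-ext h) c)
  renμ-ext h ze           = refl
  renμ-ext h (S t)        = cong S (renμ-ext h t)
  renμ-ext h (nrec r s t) = cong₃ nrec (renμ-ext h r) (renμ-ext h s) (renμ-ext h t)

  renμc-ext : ∀ {ρ ρ'} → (∀ x → ρ x ≡ ρ' x) → ∀ c → renμc ρ c ≡ renμc ρ' c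
  renμc-ext h (named α t) = cong₂ named (h α) (renμ-ext h t)

mutual
  renμ-comp : ∀ ρ ρ' t → renμ ρ (renμ ρ' t) ≡ renμ (λ x → ρ (ρ' x)) t
  renμ-comp ρ ρ' (var x)      = refl
  renμ-comp ρ ρ' (lam t)      = cong lam (renμ-comp ρ ρ' t)
  renμ-comp ρ ρ' (app t s)    = cong₂ app (renμ-comp ρ ρ' t) (renμ-comp ρ ρ' s)
  renμ-comp ρ ρ' (mu c)       =
    cong mu (trans (renμc-comp (ext ρ) (ext ρ') c) (renμc-ext (ext-comp ρ ρ') c))
  renμ-comp ρ ρ' ze           = refl
  renμ-comp ρ ρ' (S t)        = cong S (renμ-comp ρ ρ' t)
  renμ-comp ρ ρ' (nrec r s t) =
    cong₃ nrec (renμ-comp ρ ρ' r) (renμ-comp ρ ρ' s) (renμ-comp ρ ρ' t)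

  renμc-comp : ∀ ρ ρ' c → renμc ρ (renμc ρ' c) ≡ renμc (λ x → ρ (ρ' x)) c
  renμc-comp ρ ρ' (named α t) = cong (named _) (renμ-comp ρ ρ' t)

renμE-comp : ∀ ρ ρ' E → renμE ρ (renμE ρ' E) ≡ renμE (λ x → ρ (ρ' x)) E
renμE-comp ρ ρ' hole          = refl
renμE-comp ρ ρ' (appC E t)    = cong₂ appC (renμE-comp ρ ρ' E) (renμ-comp ρ ρ' t)
renμE-comp ρ ρ' (SC E)        = cong SC (renμE-comp ρ ρ' E)
renμE-comp ρ ρ' (nrecC r s E) =
  cong₃ nrecC (renμ-comp ρ ρ' r) (renμ-comp ρ ρ' s) (renμE-comp ρ ρ' E)

mutual
  renμ-id : ∀ {ρ} → (∀ x → ρ x ≡ x) → ∀ t → renμ ρ t ≡ t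
  renμ-id h (var x)      = refl
  renμ-id h (lam t)      = cong lam (renμ-id h t)
  renμ-id h (app t s)    = cong₂ app (renμ-id h t) (renμ-id h s)
  renμ-id h (mu c)       = cong mu (renμc-id (ext-id h) c)
  renμ-id h ze           = refl
  renμ-id h (S t)        = cong S (renμ-id h t)
  renμ-id h (nrec r s t) = cong₃ nrec (renμ-id h r) (renμ-id h s) (renμ-id h t)

  renμc-id : ∀ {ρ} → (∀ x → ρ x ≡ x) → ∀ c → renμc ρ c ≡ c
  renμc-id h (named α t) = cong₂ named (h α) (renμ-id h t)

renμE-id : ∀ {ρ} → (∀ x → ρ x ≡ x) → ∀ E → renμE ρ E ≡ E
renμE-id h hole          = refl
renμE-id h (appC E t)    = cong₂ appC (renμE-id h E) (renμ-id h t)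
renμE-id h (SC E)        = cong SC (renμE-id h E)
renμE-id h (nrecC r s E) = cong₃ nrecC (renμ-id h r) (renμ-id h s) (renμE-id h E)

wkμ-renμ : ∀ ρ t → wkμ (renμ ρ t) ≡ renμ (ext ρ) (wkμ t)
wkμ-renμ ρ t = trans (renμ-comp suc ρ t) (sym (renμ-comp (ext ρ) suc t))

mutual
  renλ-ext : ∀ {ρ ρ'} → (∀ x → ρ x ≡ ρ' x) → ∀ t → renλ ρ t ≡ renλ ρ' t
  renλ-ext h (var x)      = cong var (h x)
  renλ-ext h (lam t)      = cong lam (renλ-ext (ext-ext h) t)
  renλ-ext h (app t s)    = cong₂ app (renλ-ext h t) (renλ-ext h s)
  renλ-ext h (mu c)       = cong mu (renλc-ext h c)
  renλ-ext h ze           = refl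
  renλ-ext h (S t)        = cong S (renλ-ext h t)
  renλ-ext h (nrec r s t) = cong₃ nrec (renλ-ext h r) (renλ-ext h s) (renλ-ext h t)

  renλc-ext : ∀ {ρ ρ'} → (∀ x → ρ x ≡ ρ' x) → ∀ c → renλc ρ c ≡ renλc ρ' c
  renλc-ext h (named α t) = cong (named α) (renλ-ext h t)

mutual
  renλ-comp : ∀ ρ ρ' t → renλ ρ (renλ ρ' t) ≡ renλ (λ x → ρ (ρ' x)) t
  renλ-comp ρ ρ' (var x)      = refl
  renλ-comp ρ ρ' (lam t)      =
    cong lam (trans (renλ-comp (ext ρ) (ext ρ') t) (renλ-ext (ext-comp ρ ρ') t))
  renλ-comp ρ ρ' (app t s)    = cong₂ app (renλ-comp ρ ρ' t) (renλ-comp ρ ρ' s)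
  renλ-comp ρ ρ' (mu c)       = cong mu (renλc-comp ρ ρ' c)
  renλ-comp ρ ρ' ze           = refl
  renλ-comp ρ ρ' (S t)        = cong S (renλ-comp ρ ρ' t)
  renλ-comp ρ ρ' (nrec r s t) =
    cong₃ nrec (renλ-comp ρ ρ' r) (renλ-comp ρ ρ' s) (renλ-comp ρ ρ' t)

  renλc-comp : ∀ ρ ρ' c → renλc ρ (renλc ρ' c) ≡ renλc (λ x → ρ (ρ' x)) c
  renλc-comp ρ ρ' (named α t) = cong (named α) (renλ-comp ρ ρ' t)

renλE-comp : ∀ ρ ρ' E → renλE ρ (renλE ρ' E) ≡ renλE (λ x → ρ (ρ' x)) E
renλE-comp ρ ρ' hole          = refl
renλE-comp ρ ρ' (appC E t)    = cong₂ appC (renλE-comp ρ ρ' E) (renλ-comp ρ ρ' t)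
renλE-comp ρ ρ' (SC E)        = cong SC (renλE-comp ρ ρ' E)
renλE-comp ρ ρ' (nrecC r s E) =
  cong₃ nrecC (renλ-comp ρ ρ' r) (renλ-comp ρ ρ' s) (renλE-comp ρ ρ' E)

mutual
  renλμ : ∀ ρ ρ' t → renλ ρ (renμ ρ' t) ≡ renμ ρ' (renλ ρ t)
  renλμ ρ ρ' (var x)      = refl
  renλμ ρ ρ' (lam t)      = cong lam (renλμ (ext ρ) ρ' t)
  renλμ ρ ρ' (app t s)    = cong₂ app (renλμ ρ ρ' t) (renλμ ρ ρ' s)
  renλμ ρ ρ' (mu c)       = cong mu (renλμc ρ (ext ρ') c)
  renλμ ρ ρ' ze           = refl
  renλμ ρ ρ' (S t)        = cong S (renλμ ρ ρ' t)
  renλμ ρ ρ' (nrec r s t) = cong₃ nrec (renλμ ρ ρ' r) (renλμ ρ ρ' s) (renλμ ρ ρ' t)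

  renλμc : ∀ ρ ρ' c → renλc ρ (renμc ρ' c) ≡ renμc ρ' (renλc ρ c)
  renλμc ρ ρ' (named α t) = cong (named _) (renλμ ρ ρ' t)

renλμE : ∀ ρ ρ' E → renλE ρ (renμE ρ' E) ≡ renμE ρ' (renλE ρ E)
renλμE ρ ρ' hole          = refl
renλμE ρ ρ' (appC E t)    = cong₂ appC (renλμE ρ ρ' E) (renλμ ρ ρ' t)
renλμE ρ ρ' (SC E)        = cong SC (renλμE ρ ρ' E)
renλμE ρ ρ' (nrecC r s E) = cong₃ nrecC (renλμ ρ ρ' r) (renλμ ρ ρ' s) (renλμE ρ ρ' E)

_∘E_ : Ctx → Ctx → Ctx
hole        ∘E F = F
appC E t    ∘E F = appC (E ∘E F) t
SC E        ∘E F = SC (E ∘E F)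
nrecC r s E ∘E F = nrecC r s (E ∘E F)

plug-∘ : ∀ E F q → plug (E ∘E F) q ≡ plug E (plug F q)
plug-∘ hole          F q = refl
plug-∘ (appC E t)    F q = cong (λ x → app x t) (plug-∘ E F q)
plug-∘ (SC E)        F q = cong S (plug-∘ E F q)
plug-∘ (nrecC r s E) F q = cong (nrec r s) (plug-∘ E F q)

∘E-hole : ∀ E → E ∘E hole ≡ E
∘E-hole hole          = refl
∘E-hole (appC E t)    = cong (λ x → appC x t) (∘E-hole E)
∘E-hole (SC E)        = cong SC (∘E-hole E)
∘E-hole (nrecC r s E) = cong (nrecC r s) (∘E-hole E)

renμ-plug : ∀ ρ E q → renμ ρ (plug E q) ≡ plug (renμE ρ E) (renμ ρ q)
renμ-plug ρ hole          q = refl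
renμ-plug ρ (appC E t)    q = cong (λ x → app x (renμ ρ t)) (renμ-plug ρ E q)
renμ-plug ρ (SC E)        q = cong S (renμ-plug ρ E q)
renμ-plug ρ (nrecC r s E) q = cong (nrec _ _) (renμ-plug ρ E q)

renλ-plug : ∀ ρ E q → renλ ρ (plug E q) ≡ plug (renλE ρ E) (renλ ρ q)
renλ-plug ρ hole          q = refl
renλ-plug ρ (appC E t)    q = cong (λ x → app x (renλ ρ t)) (renλ-plug ρ E q)
renλ-plug ρ (SC E)        q = cong S (renλ-plug ρ E q)
renλ-plug ρ (nrecC r s E) q = cong (nrec _ _) (renλ-plug ρ E q)

renμE-∘ : ∀ ρ E F → renμE ρ (E ∘E F) ≡ renμE ρ E ∘E renμE ρ F
renμE-∘ ρ hole          F = refl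
renμE-∘ ρ (appC E t)    F = cong (λ x → appC x _) (renμE-∘ ρ E F)
renμE-∘ ρ (SC E)        F = cong SC (renμE-∘ ρ E F)
renμE-∘ ρ (nrecC r s E) F = cong (nrecC _ _) (renμE-∘ ρ E F)

renλE-∘ : ∀ ρ E F → renλE ρ (E ∘E F) ≡ renλE ρ E ∘E renλE ρ F
renλE-∘ ρ hole          F = refl
renλE-∘ ρ (appC E t)    F = cong (λ x → appC x _) (renλE-∘ ρ E F)
renλE-∘ ρ (SC E)        F = cong SC (renλE-∘ ρ E F)
renλE-∘ ρ (nrecC r s E) F = cong (nrecC _ _) (renλE-∘ ρ E F)

liftκ : (ℕ → Ctx) → ℕ → Ctx
liftκ κ zero    = hole
liftκ κ (suc n) = renμE suc (κ n)

mutual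
  ms : (ℕ → ℕ) → (ℕ → Ctx) → Tm → Tm
  ms ρ κ (var x)      = var x
  ms ρ κ (lam t)      = lam (ms ρ (λ n → renλE suc (κ n)) t)
  ms ρ κ (app t s)    = app (ms ρ κ t) (ms ρ κ s)
  ms ρ κ (mu c)       = mu (msc (ext ρ) (liftκ κ) c)
  ms ρ κ ze           = ze
  ms ρ κ (S t)        = S (ms ρ κ t)
  ms ρ κ (nrec r s t) = nrec (ms ρ κ r) (ms ρ κ s) (ms ρ κ t)

  msc : (ℕ → ℕ) → (ℕ → Ctx) → Cmd → Cmd
  msc ρ κ (named γ q) = named (ρ γ) (plug (κ γ) (ms ρ κ q))

msE : (ℕ → ℕ) → (ℕ → Ctx) → Ctx → Ctx
msE ρ κ hole          = hole
msE ρ κ (appC E t)    = appC (msE ρ κ E) (ms ρ κ t)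
msE ρ κ (SC E)        = SC (msE ρ κ E)
msE ρ κ (nrecC r s E) = nrecC (ms ρ κ r) (ms ρ κ s) (msE ρ κ E)

ms-plug : ∀ ρ κ E q → ms ρ κ (plug E q) ≡ plug (msE ρ κ E) (ms ρ κ q)
ms-plug ρ κ hole          q = refl
ms-plug ρ κ (appC E t)    q = cong (λ x → app x _) (ms-plug ρ κ E q)
ms-plug ρ κ (SC E)        q = cong S (ms-plug ρ κ E q)
ms-plug ρ κ (nrecC r s E) q = cong (nrec _ _) (ms-plug ρ κ E q)

liftκ-ext : ∀ {κ κ' : ℕ → Ctx} → (∀ x → κ x ≡ κ' x) → ∀ x → liftκ κ x ≡ liftκ κ' x
liftκ-ext h zero    = refl
liftκ-ext h (suc x) = cong (renμE suc) (h x)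

mutual
  ms-ext : ∀ {ρ ρ' κ κ'} → (∀ x → ρ x ≡ ρ' x) → (∀ x → κ x ≡ κ' x) →
           ∀ t → ms ρ κ t ≡ ms ρ' κ' t
  ms-ext h k (var x)      = refl
  ms-ext h k (lam t)      = cong lam (ms-ext h (λ x → cong (renλE suc) (k x)) t)
  ms-ext h k (app t s)    = cong₂ app (ms-ext h k t) (ms-ext h k s)
  ms-ext h k (mu c)       = cong mu (msc-ext (ext-ext h) (liftκ-ext k) c)
  ms-ext h k ze           = refl
  ms-ext h k (S t)        = cong S (ms-ext h k t)
  ms-ext h k (nrec r s t) = cong₃ nrec (ms-ext h k r) (ms-ext h k s) (ms-ext h k t)

  msc-ext : ∀ {ρ ρ' κ κ'} → (∀ x → ρ x ≡ ρ' x) → (∀ x → κ x ≡ κ' x) →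
            ∀ c → msc ρ κ c ≡ msc ρ' κ' c
  msc-ext h k (named γ q) = cong₂ named (h γ) (cong₂ plug (k γ) (ms-ext h k q))

mutual
  renμ-ms : ∀ ρ' ρ κ t → renμ ρ' (ms ρ κ t) ≡ ms (λ x → ρ' (ρ x)) (λ x → renμE ρ' (κ x)) t
  renμ-ms ρ' ρ κ (var x)      = refl
  renμ-ms ρ' ρ κ (lam t)      = cong lam (trans (renμ-ms ρ' ρ _ t)
      (ms-ext (λ _ → refl) (λ x → sym (renλμE suc ρ' (κ x))) t))
  renμ-ms ρ' ρ κ (app t s)    = cong₂ app (renμ-ms ρ' ρ κ t) (renμ-ms ρ' ρ κ s)
  renμ-ms ρ' ρ κ (mu c)       = cong mu (trans (renμc-ms (ext ρ') (ext ρ) (liftκ κ) c)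
      (msc-ext (ext-comp ρ' ρ) lifted c))
    where
      lifted : ∀ x → renμE (ext ρ') (liftκ κ x) ≡ liftκ (λ y → renμE ρ' (κ y)) x
      lifted zero    = refl
      lifted (suc x) = trans (renμE-comp (ext ρ') suc (κ x)) (sym (renμE-comp suc ρ' (κ x)))
  renμ-ms ρ' ρ κ ze           = refl
  renμ-ms ρ' ρ κ (S t)        = cong S (renμ-ms ρ' ρ κ t)
  renμ-ms ρ' ρ κ (nrec r s t) =
    cong₃ nrec (renμ-ms ρ' ρ κ r) (renμ-ms ρ' ρ κ s) (renμ-ms ρ' ρ κ t)

  renμc-ms : ∀ ρ' ρ κ c →
             renμc ρ' (msc ρ κ c) ≡ msc (λ x → ρ' (ρ x)) (λ x → renμE ρ' (κ x)) c
  renμc-ms ρ' ρ κ (named γ q) = cong (named _) (trans (renμ-plug ρ' (κ γ) (ms ρ κ q))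
      (cong (plug _) (renμ-ms ρ' ρ κ q)))

renμE-msE : ∀ ρ' ρ κ E →
            renμE ρ' (msE ρ κ E) ≡ msE (λ x → ρ' (ρ x)) (λ x → renμE ρ' (κ x)) E
renμE-msE ρ' ρ κ hole          = refl
renμE-msE ρ' ρ κ (appC E t)    = cong₂ appC (renμE-msE ρ' ρ κ E) (renμ-ms ρ' ρ κ t)
renμE-msE ρ' ρ κ (SC E)        = cong SC (renμE-msE ρ' ρ κ E)
renμE-msE ρ' ρ κ (nrecC r s E) =
  cong₃ nrecC (renμ-ms ρ' ρ κ r) (renμ-ms ρ' ρ κ s) (renμE-msE ρ' ρ κ E)

mutual
  ms-renμ : ∀ ρ κ ρ' t → ms ρ κ (renμ ρ' t) ≡ ms (λ x → ρ (ρ' x)) (λ x → κ (ρ' x)) t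
  ms-renμ ρ κ ρ' (var x)      = refl
  ms-renμ ρ κ ρ' (lam t)      = cong lam (ms-renμ ρ _ ρ' t)
  ms-renμ ρ κ ρ' (app t s)    = cong₂ app (ms-renμ ρ κ ρ' t) (ms-renμ ρ κ ρ' s)
  ms-renμ ρ κ ρ' (mu c)       = cong mu (trans (msc-renμ (ext ρ) (liftκ κ) (ext ρ') c)
      (msc-ext (ext-comp ρ ρ') lifted c))
    where
      lifted : ∀ x → liftκ κ (ext ρ' x) ≡ liftκ (λ y → κ (ρ' y)) x
      lifted zero    = refl
      lifted (suc x) = refl
  ms-renμ ρ κ ρ' ze           = refl
  ms-renμ ρ κ ρ' (S t)        = cong S (ms-renμ ρ κ ρ' t)
  ms-renμ ρ κ ρ' (nrec r s t) =
    cong₃ nrec (ms-renμ ρ κ ρ' r) (ms-renμ ρ κ ρ' s) (ms-renμ ρ κ ρ' t)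

  msc-renμ : ∀ ρ κ ρ' c →
             msc ρ κ (renμc ρ' c) ≡ msc (λ x → ρ (ρ' x)) (λ x → κ (ρ' x)) c
  msc-renμ ρ κ ρ' (named γ q) = cong (named _) (cong (plug _) (ms-renμ ρ κ ρ' q))

msE-renμE : ∀ ρ κ ρ' E →
            msE ρ κ (renμE ρ' E) ≡ msE (λ x → ρ (ρ' x)) (λ x → κ (ρ' x)) E
msE-renμE ρ κ ρ' hole          = refl
msE-renμE ρ κ ρ' (appC E t)    = cong₂ appC (msE-renμE ρ κ ρ' E) (ms-renμ ρ κ ρ' t)
msE-renμE ρ κ ρ' (SC E)        = cong SC (msE-renμE ρ κ ρ' E)
msE-renμE ρ κ ρ' (nrecC r s E) =
  cong₃ nrecC (ms-renμ ρ κ ρ' r) (ms-renμ ρ κ ρ' s) (msE-renμE ρ κ ρ' E)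

mutual
  ms-ren : ∀ {ρ κ} → (∀ x → κ x ≡ hole) → ∀ t → ms ρ κ t ≡ renμ ρ t
  ms-ren k (var x)      = refl
  ms-ren k (lam t)      = cong lam (ms-ren (λ x → cong (renλE suc) (k x)) t)
  ms-ren k (app t s)    = cong₂ app (ms-ren k t) (ms-ren k s)
  ms-ren {κ = κ} k (mu c) = cong mu (msc-ren lifted c)
    where
      lifted : ∀ x → liftκ κ x ≡ hole
      lifted zero    = refl
      lifted (suc x) = cong (renμE suc) (k x)
  ms-ren k ze           = refl
  ms-ren k (S t)        = cong S (ms-ren k t)
  ms-ren k (nrec r s t) = cong₃ nrec (ms-ren k r) (ms-ren k s) (ms-ren k t)

  msc-ren : ∀ {ρ κ} → (∀ x → κ x ≡ hole) → ∀ c → msc ρ κ c ≡ renμc ρ c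
  msc-ren {ρ} {κ} k (named γ q) =
    cong (named _) (trans (cong (λ E → plug E (ms ρ κ q)) (k γ)) (ms-ren k q))

msE-ren : ∀ {ρ κ} → (∀ x → κ x ≡ hole) → ∀ E → msE ρ κ E ≡ renμE ρ E
msE-ren k hole          = refl
msE-ren k (appC E t)    = cong₂ appC (msE-ren k E) (ms-ren k t)
msE-ren k (SC E)        = cong SC (msE-ren k E)
msE-ren k (nrecC r s E) = cong₃ nrecC (ms-ren k r) (ms-ren k s) (msE-ren k E)

mutual
  renλ-ms : ∀ ρ' ρ κ t → renλ ρ' (ms ρ κ t) ≡ ms ρ (λ x → renλE ρ' (κ x)) (renλ ρ' t)
  renλ-ms ρ' ρ κ (var x)      = refl
  renλ-ms ρ' ρ κ (lam t)      = cong lam (trans (renλ-ms (ext ρ') ρ _ t)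
      (ms-ext (λ _ → refl)
              (λ x → trans (renλE-comp (ext ρ') suc (κ x)) (sym (renλE-comp suc ρ' (κ x)))) _))
  renλ-ms ρ' ρ κ (app t s)    = cong₂ app (renλ-ms ρ' ρ κ t) (renλ-ms ρ' ρ κ s)
  renλ-ms ρ' ρ κ (mu c)       = cong mu (trans (renλc-ms ρ' (ext ρ) (liftκ κ) c)
      (msc-ext (λ _ → refl) lifted _))
    where
      lifted : ∀ x → renλE ρ' (liftκ κ x) ≡ liftκ (λ y → renλE ρ' (κ y)) x
      lifted zero    = refl
      lifted (suc x) = renλμE ρ' suc (κ x)
  renλ-ms ρ' ρ κ ze           = refl
  renλ-ms ρ' ρ κ (S t)        = cong S (renλ-ms ρ' ρ κ t)
  renλ-ms ρ' ρ κ (nrec r s t) =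
    cong₃ nrec (renλ-ms ρ' ρ κ r) (renλ-ms ρ' ρ κ s) (renλ-ms ρ' ρ κ t)

  renλc-ms : ∀ ρ' ρ κ c →
             renλc ρ' (msc ρ κ c) ≡ msc ρ (λ x → renλE ρ' (κ x)) (renλc ρ' c)
  renλc-ms ρ' ρ κ (named γ q) = cong (named _) (trans (renλ-plug ρ' (κ γ) (ms ρ κ q))
      (cong (plug _) (renλ-ms ρ' ρ κ q)))

renλE-msE : ∀ ρ' ρ κ E →
            renλE ρ' (msE ρ κ E) ≡ msE ρ (λ x → renλE ρ' (κ x)) (renλE ρ' E)
renλE-msE ρ' ρ κ hole          = refl
renλE-msE ρ' ρ κ (appC E t)    = cong₂ appC (renλE-msE ρ' ρ κ E) (renλ-ms ρ' ρ κ t)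
renλE-msE ρ' ρ κ (SC E)        = cong SC (renλE-msE ρ' ρ κ E)
renλE-msE ρ' ρ κ (nrecC r s E) =
  cong₃ nrecC (renλ-ms ρ' ρ κ r) (renλ-ms ρ' ρ κ s) (renλE-msE ρ' ρ κ E)

_⊙κ_ : ((ℕ → ℕ) × (ℕ → Ctx)) → ((ℕ → ℕ) × (ℕ → Ctx)) → ℕ → Ctx
((ψρ , ψκ) ⊙κ (φρ , φκ)) γ = ψκ (φρ γ) ∘E msE ψρ ψκ (φκ γ)

msE-wk : ∀ ρ κ F → msE (ext ρ) (liftκ κ) (renμE suc F) ≡ renμE suc (msE ρ κ F)
msE-wk ρ κ F = trans (msE-renμE (ext ρ) (liftκ κ) suc F) (sym (renμE-msE suc ρ κ F))

mutual
  ms-ms : ∀ ψρ ψκ φρ φκ t →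
          ms ψρ ψκ (ms φρ φκ t) ≡ ms (λ x → ψρ (φρ x)) ((ψρ , ψκ) ⊙κ (φρ , φκ)) t
  ms-ms ψρ ψκ φρ φκ (var x)      = refl
  ms-ms ψρ ψκ φρ φκ (lam t)      = cong lam (trans (ms-ms ψρ _ φρ _ t) (ms-ext (λ _ → refl) under-lam t))
    where
      under-lam : ∀ x → ((ψρ , (λ n → renλE suc (ψκ n))) ⊙κ (φρ , (λ n → renλE suc (φκ n)))) x
                        ≡ renλE suc (((ψρ , ψκ) ⊙κ (φρ , φκ)) x)
      under-lam x = trans (cong (renλE suc (ψκ (φρ x)) ∘E_) (sym (renλE-msE suc ψρ ψκ (φκ x))))
                          (sym (renλE-∘ suc (ψκ (φρ x)) _))
  ms-ms ψρ ψκ φρ φκ (app t s)    = cong₂ app (ms-ms ψρ ψκ φρ φκ t) (ms-ms ψρ ψκ φρ φκ s)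
  ms-ms ψρ ψκ φρ φκ (mu c)       =
    cong mu (trans (msc-msc (ext ψρ) (liftκ ψκ) (ext φρ) (liftκ φκ) c)
                   (msc-ext (ext-comp ψρ φρ) under-mu c))
    where
      under-mu : ∀ x → ((ext ψρ , liftκ ψκ) ⊙κ (ext φρ , liftκ φκ)) x
                       ≡ liftκ ((ψρ , ψκ) ⊙κ (φρ , φκ)) x
      under-mu zero    = refl
      under-mu (suc x) = trans (cong (renμE suc (ψκ (φρ x)) ∘E_) (msE-wk ψρ ψκ (φκ x)))
                               (sym (renμE-∘ suc (ψκ (φρ x)) _))
  ms-ms ψρ ψκ φρ φκ ze           = refl
  ms-ms ψρ ψκ φρ φκ (S t)        = cong S (ms-ms ψρ ψκ φρ φκ t)
  ms-ms ψρ ψκ φρ φκ (nrec r s t) =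
    cong₃ nrec (ms-ms ψρ ψκ φρ φκ r) (ms-ms ψρ ψκ φρ φκ s) (ms-ms ψρ ψκ φρ φκ t)

  msc-msc : ∀ ψρ ψκ φρ φκ c →
            msc ψρ ψκ (msc φρ φκ c) ≡ msc (λ x → ψρ (φρ x)) ((ψρ , ψκ) ⊙κ (φρ , φκ)) c
  msc-msc ψρ ψκ φρ φκ (named γ q) = cong (named _)
    (trans (cong (plug (ψκ (φρ γ))) (trans (ms-plug ψρ ψκ (φκ γ) (ms φρ φκ q))
                                          (cong (plug _) (ms-ms ψρ ψκ φρ φκ q))))
           (sym (plug-∘ (ψκ (φρ γ)) _ _)))

κss : ℕ → Ctx → ℕ → Ctx
κss α E γ = if γ ≡ᵇ α then E else hole

mutual
  ss-ms : ∀ {ρ} → (∀ x → ρ x ≡ x) → ∀ α E t → ss α E t ≡ ms ρ (κss α E) t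
  ss-ms h α E (var x)      = refl
  ss-ms h α E (lam t)      = cong lam (trans (ss-ms h α _ t) (ms-ext (λ _ → refl) under-lam t))
    where
      under-lam : ∀ x → κss α (renλE suc E) x ≡ renλE suc (κss α E x)
      under-lam x with x ≡ᵇ α
      ... | true  = refl
      ... | false = refl
  ss-ms h α E (app t s)    = cong₂ app (ss-ms h α E t) (ss-ms h α E s)
  ss-ms h α E (mu c)       =
    cong mu (trans (ssc-ms (ext-id h) (suc α) _ c) (msc-ext (λ _ → refl) under-mu c))
    where
      under-mu : ∀ x → κss (suc α) (renμE suc E) x ≡ liftκ (κss α E) x
      under-mu zero = refl
      under-mu (suc x) with x ≡ᵇ α
      ... | true  = refl
      ... | false = refl
  ss-ms h α E ze           = refl
  ss-ms h α E (S t)        = cong S (ss-ms h α E t)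
  ss-ms h α E (nrec r s t) = cong₃ nrec (ss-ms h α E r) (ss-ms h α E s) (ss-ms h α E t)

  ssc-ms : ∀ {ρ} → (∀ x → ρ x ≡ x) → ∀ α E c → ssc α E c ≡ msc ρ (κss α E) c
  ssc-ms h α E (named γ q) with γ ≡ᵇ α
  ... | true  = cong₂ named (sym (h γ)) (cong (plug E) (ss-ms h α E q))
  ... | false = cong₂ named (sym (h γ)) (ss-ms h α E q)

extsλ-ext : ∀ {σ σ' : ℕ → Tm} → (∀ x → σ x ≡ σ' x) → ∀ x → extsλ σ x ≡ extsλ σ' x
extsλ-ext h zero    = refl
extsλ-ext h (suc x) = cong (renλ suc) (h x)

mutual
  sub-ext : ∀ {σ σ'} → (∀ x → σ x ≡ σ' x) → ∀ t → sub σ t ≡ sub σ' t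
  sub-ext h (var x)      = h x
  sub-ext h (lam t)      = cong lam (sub-ext (extsλ-ext h) t)
  sub-ext h (app t s)    = cong₂ app (sub-ext h t) (sub-ext h s)
  sub-ext h (mu c)       = cong mu (subc-ext (λ x → cong (renμ suc) (h x)) c)
  sub-ext h ze           = refl
  sub-ext h (S t)        = cong S (sub-ext h t)
  sub-ext h (nrec r s t) = cong₃ nrec (sub-ext h r) (sub-ext h s) (sub-ext h t)

  subc-ext : ∀ {σ σ'} → (∀ x → σ x ≡ σ' x) → ∀ c → subc σ c ≡ subc σ' c
  subc-ext h (named α t) = cong (named α) (sub-ext h t)

mutual
  renμ-sub : ∀ ρ σ t → renμ ρ (sub σ t) ≡ sub (λ n → renμ ρ (σ n)) (renμ ρ t)
  renμ-sub ρ σ (var x)      = refl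
  renμ-sub ρ σ (lam t)      = cong lam (trans (renμ-sub ρ (extsλ σ) t) (sub-ext under-lam (renμ ρ t)))
    where
      under-lam : ∀ x → renμ ρ (extsλ σ x) ≡ extsλ (λ n → renμ ρ (σ n)) x
      under-lam zero    = refl
      under-lam (suc x) = sym (renλμ suc ρ (σ x))
  renμ-sub ρ σ (app t s)    = cong₂ app (renμ-sub ρ σ t) (renμ-sub ρ σ s)
  renμ-sub ρ σ (mu c)       = cong mu (trans (renμc-sub (ext ρ) _ c)
     (subc-ext (λ x → sym (wkμ-renμ ρ (σ x))) _))
  renμ-sub ρ σ ze           = refl
  renμ-sub ρ σ (S t)        = cong S (renμ-sub ρ σ t)
  renμ-sub ρ σ (nrec r s t) = cong₃ nrec (renμ-sub ρ σ r) (renμ-sub ρ σ s) (renμ-sub ρ σ t)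

  renμc-sub : ∀ ρ σ c → renμc ρ (subc σ c) ≡ subc (λ n → renμ ρ (σ n)) (renμc ρ c)
  renμc-sub ρ σ (named α t) = cong (named _) (renμ-sub ρ σ t)

renμ-sub1 : ∀ ρ t r → renμ ρ (t [0:= r ]) ≡ (renμ ρ t) [0:= renμ ρ r ]
renμ-sub1 ρ t r = trans (renμ-sub ρ (sub1 r) t) (sub-ext pointwise (renμ ρ t))
  where
    pointwise : ∀ x → renμ ρ (sub1 r x) ≡ sub1 (renμ ρ r) x
    pointwise zero    = refl
    pointwise (suc x) = refl

renμ-num : ∀ ρ n → renμ ρ (num n) ≡ num n
renμ-num ρ zero    = refl
renμ-num ρ (suc n) = cong S (renμ-num ρ n)

renμ-num⁻ : ∀ ρ z n → renμ ρ z ≡ num n → z ≡ num n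
renμ-num⁻ ρ ze             zero    eq = refl
renμ-num⁻ ρ (S z)          (suc n) eq = cong S (renμ-num⁻ ρ z n (cong predS eq))
  where
    predS : Tm → Tm
    predS (S a) = a
    predS a     = a
renμ-num⁻ ρ (var x)        zero    ()
renμ-num⁻ ρ (lam z)        zero    ()
renμ-num⁻ ρ (app z z₁)     zero    ()
renμ-num⁻ ρ (mu x)         zero    ()
renμ-num⁻ ρ (S z)          zero    ()
renμ-num⁻ ρ (nrec z z₁ z₂) zero    ()
renμ-num⁻ ρ (var x)        (suc n) ()
renμ-num⁻ ρ (lam z)        (suc n) ()
renμ-num⁻ ρ (app z z₁)     (suc n) ()
renμ-num⁻ ρ (mu x)         (suc n) ()
renμ-num⁻ ρ ze             (suc n) ()
renμ-num⁻ ρ (nrec z z₁ z₂) (suc n) ()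

_→Ac_ : Cmd → Cmd → Set
_→Ac_ = CompatC RootA RootAc
_→Bc_ : Cmd → Cmd → Set
_→Bc_ = CompatC RootB RootBc
_→ABc_ : Cmd → Cmd → Set
_→ABc_ = CompatC (RootA ∪ RootB) (RootAc ∪ RootBc)

A* B* AB* : Tm → Tm → Set
A*  = Star _→A_
B*  = Star _→B_
AB* = Star _→AB_

Bc* ABc* : Cmd → Cmd → Set
Bc*  = Star _→Bc_
ABc* = Star _→ABc_

module Congruence {R : Tm → Tm → Set} {Rc : Cmd → Cmd → Set} where
  private
    Rt  = Compat R Rc
    Rcc = CompatC R Rc

  lam* : ∀ {t t'} → Star Rt t t' → Star Rt (lam t) (lam t')
  lam* = gmap lam lamξ
  appL* : ∀ {t t' s} → Star Rt t t' → Star Rt (app t s) (app t' s)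
  appL* {s = s} = gmap (λ x → app x s) appξ₁
  appR* : ∀ {t s s'} → Star Rt s s' → Star Rt (app t s) (app t s')
  appR* {t = t} = gmap (app t) appξ₂
  mu* : ∀ {c c'} → Star Rcc c c' → Star Rt (mu c) (mu c')
  mu* = gmap mu muξ
  S* : ∀ {t t'} → Star Rt t t' → Star Rt (S t) (S t')
  S* = gmap S Sξ
  nrec1* : ∀ {r r' s t} → Star Rt r r' → Star Rt (nrec r s t) (nrec r' s t)
  nrec1* {s = s} {t} = gmap (λ x → nrec x s t) nrecξ₁
  nrec2* : ∀ {r s s' t} → Star Rt s s' → Star Rt (nrec r s t) (nrec r s' t)
  nrec2* {r = r} {t = t} = gmap (λ x → nrec r x t) nrecξ₂
  nrec3* : ∀ {r s t t'} → Star Rt t t' → Star Rt (nrec r s t) (nrec r s t')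
  nrec3* {r = r} {s} = gmap (nrec r s) nrecξ₃
  named* : ∀ {α t t'} → Star Rt t t' → Star Rcc (named α t) (named α t')
  named* {α} = gmap (named α) namedξ

  plug1 : ∀ E {q q'} → Rt q q' → Rt (plug E q) (plug E q')
  plug1 hole          st = st
  plug1 (appC E t)    st = appξ₁ (plug1 E st)
  plug1 (SC E)        st = Sξ (plug1 E st)
  plug1 (nrecC r s E) st = nrecξ₃ (plug1 E st)

  plug* : ∀ E {q q'} → Star Rt q q' → Star Rt (plug E q) (plug E q')
  plug* E = gmap (plug E) (plug1 E)

open Congruence public

mutual
  compat-mono : ∀ {R R' Rc Rc'} → (∀ {a b} → R a b → R' a b) → (∀ {a b} → Rc a b → Rc' a b) →
                ∀ {t u} → Compat R Rc t u → Compat R' Rc' t u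
  compat-mono f g (root x)     = root (f x)
  compat-mono f g (lamξ st)    = lamξ (compat-mono f g st)
  compat-mono f g (appξ₁ st)   = appξ₁ (compat-mono f g st)
  compat-mono f g (appξ₂ st)   = appξ₂ (compat-mono f g st)
  compat-mono f g (muξ st)     = muξ (compatC-mono f g st)
  compat-mono f g (Sξ st)      = Sξ (compat-mono f g st)
  compat-mono f g (nrecξ₁ st)  = nrecξ₁ (compat-mono f g st)
  compat-mono f g (nrecξ₂ st)  = nrecξ₂ (compat-mono f g st)
  compat-mono f g (nrecξ₃ st)  = nrecξ₃ (compat-mono f g st)

  compatC-mono : ∀ {R R' Rc Rc'} → (∀ {a b} → R a b → R' a b) → (∀ {a b} → Rc a b → Rc' a b) →
                 ∀ {t u} → CompatC R Rc t u → CompatC R' Rc' t u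
  compatC-mono f g (rootc x)   = rootc (g x)
  compatC-mono f g (namedξ st) = namedξ (compat-mono f g st)

A⇒AB : ∀ {t u} → t →A u → t →AB u
A⇒AB = compat-mono inj₁ inj₁
B⇒AB : ∀ {t u} → t →B u → t →AB u
B⇒AB = compat-mono inj₂ inj₂
Bc⇒ABc : ∀ {t u} → t →Bc u → t →ABc u
Bc⇒ABc = compatC-mono inj₂ inj₂
A*⇒AB* : ∀ {t u} → A* t u → AB* t u
A*⇒AB* = gmap (λ x → x) A⇒AB
B*⇒AB* : ∀ {t u} → B* t u → AB* t u
B*⇒AB* = gmap (λ x → x) B⇒AB

mutual
  splitAB : ∀ {t u} → t →AB u → (t →A u) ⊎ (t →B u)
  splitAB (root (inj₁ x)) = inj₁ (root x)
  splitAB (root (inj₂ y)) = inj₂ (root y)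
  splitAB (lamξ st)       = ⊎-map lamξ lamξ (splitAB st)
  splitAB (appξ₁ st)      = ⊎-map appξ₁ appξ₁ (splitAB st)
  splitAB (appξ₂ st)      = ⊎-map appξ₂ appξ₂ (splitAB st)
  splitAB (muξ st)        = ⊎-map muξ muξ (splitABc st)
  splitAB (Sξ st)         = ⊎-map Sξ Sξ (splitAB st)
  splitAB (nrecξ₁ st)     = ⊎-map nrecξ₁ nrecξ₁ (splitAB st)
  splitAB (nrecξ₂ st)     = ⊎-map nrecξ₂ nrecξ₂ (splitAB st)
  splitAB (nrecξ₃ st)     = ⊎-map nrecξ₃ nrecξ₃ (splitAB st)

  splitABc : ∀ {t u} → t →ABc u → (t →Ac u) ⊎ (t →Bc u)
  splitABc (rootc (inj₁ ()))
  splitABc (rootc (inj₂ y)) = inj₂ (rootc y)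
  splitABc (namedξ st)      = ⊎-map namedξ namedξ (splitAB st)

contract-ext : ∀ ρ α x → contract (ρ α) (ext ρ x) ≡ ρ (contract α x)
contract-ext ρ α zero    = refl
contract-ext ρ α (suc x) = refl

mutual
  B-renμ : ∀ ρ {t u} → t →B u → renμ ρ t →B renμ ρ u
  B-renμ ρ (root (μη q))  =
    subst (λ x → mu (named zero x) →B renμ ρ q) (wkμ-renμ ρ q) (root (μη (renμ ρ q)))
  B-renμ ρ (lamξ st)      = lamξ (B-renμ ρ st)
  B-renμ ρ (appξ₁ st)     = appξ₁ (B-renμ ρ st)
  B-renμ ρ (appξ₂ st)     = appξ₂ (B-renμ ρ st)
  B-renμ ρ (muξ st)       = muξ (B-renμc (ext ρ) st)
  B-renμ ρ (Sξ st)        = Sξ (B-renμ ρ st)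
  B-renμ ρ (nrecξ₁ st)    = nrecξ₁ (B-renμ ρ st)
  B-renμ ρ (nrecξ₂ st)    = nrecξ₂ (B-renμ ρ st)
  B-renμ ρ (nrecξ₃ st)    = nrecξ₃ (B-renμ ρ st)

  B-renμc : ∀ ρ {c c'} → c →Bc c' → renμc ρ c →Bc renμc ρ c'
  B-renμc ρ (rootc (μβ α c)) =
    subst (λ x → named (ρ α) (mu (renμc (ext ρ) c)) →Bc x) contracted
          (rootc (μβ (ρ α) (renμc (ext ρ) c)))
    where
      contracted : renμc (contract (ρ α)) (renμc (ext ρ) c) ≡ renμc ρ (renμc (contract α) c)
      contracted = trans (renμc-comp _ _ c)
                         (trans (renμc-ext (contract-ext ρ α) c) (sym (renμc-comp ρ (contract α) c)))
  B-renμc ρ (namedξ st) = namedξ (B-renμ ρ st)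

mutual
  B-renλ : ∀ ρ {t u} → t →B u → renλ ρ t →B renλ ρ u
  B-renλ ρ (root (μη q))  =
    subst (λ x → mu (named zero x) →B renλ ρ q) (sym (renλμ ρ suc q)) (root (μη (renλ ρ q)))
  B-renλ ρ (lamξ st)      = lamξ (B-renλ (ext ρ) st)
  B-renλ ρ (appξ₁ st)     = appξ₁ (B-renλ ρ st)
  B-renλ ρ (appξ₂ st)     = appξ₂ (B-renλ ρ st)
  B-renλ ρ (muξ st)       = muξ (B-renλc ρ st)
  B-renλ ρ (Sξ st)        = Sξ (B-renλ ρ st)
  B-renλ ρ (nrecξ₁ st)    = nrecξ₁ (B-renλ ρ st)
  B-renλ ρ (nrecξ₂ st)    = nrecξ₂ (B-renλ ρ st)
  B-renλ ρ (nrecξ₃ st)    = nrecξ₃ (B-renλ ρ st)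

  B-renλc : ∀ ρ {c c'} → c →Bc c' → renλc ρ c →Bc renλc ρ c'
  B-renλc ρ (rootc (μβ α c)) =
    subst (λ x → named α (mu (renλc ρ c)) →Bc x) (sym (renλμc ρ (contract α) c))
          (rootc (μβ α (renλc ρ c)))
  B-renλc ρ (namedξ st) = namedξ (B-renλ ρ st)

mutual
  B-sub : ∀ σ {t u} → t →B u → sub σ t →B sub σ u
  B-sub σ (root (μη q))  =
    subst (λ x → mu (named zero x) →B sub σ q) (renμ-sub suc σ q) (root (μη (sub σ q)))
  B-sub σ (lamξ st)      = lamξ (B-sub (extsλ σ) st)
  B-sub σ (appξ₁ st)     = appξ₁ (B-sub σ st)
  B-sub σ (appξ₂ st)     = appξ₂ (B-sub σ st)
  B-sub σ (muξ st)       = muξ (B-subc _ st)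
  B-sub σ (Sξ st)        = Sξ (B-sub σ st)
  B-sub σ (nrecξ₁ st)    = nrecξ₁ (B-sub σ st)
  B-sub σ (nrecξ₂ st)    = nrecξ₂ (B-sub σ st)
  B-sub σ (nrecξ₃ st)    = nrecξ₃ (B-sub σ st)

  B-subc : ∀ σ {c c'} → c →Bc c' → subc σ c →Bc subc σ c'
  B-subc σ (rootc (μβ α c)) =
    subst (λ x → named α (mu (subc σ' c)) →Bc x) contracted (rootc (μβ α (subc σ' c)))
    where
      σ' : ℕ → Tm
      σ' n = wkμ (σ n)
      contracted : renμc (contract α) (subc σ' c) ≡ subc σ (renμc (contract α) c)
      contracted = trans (renμc-sub (contract α) σ' c)
        (subc-ext (λ x → trans (renμ-comp (contract α) suc (σ x)) (renμ-id (λ _ → refl) (σ x))) _)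
  B-subc σ (namedξ st) = namedξ (B-sub σ st)

mutual
  B*-sub : ∀ {σ σ'} → (∀ x → B* (σ x) (σ' x)) → ∀ t → B* (sub σ t) (sub σ' t)
  B*-sub h (var x)      = h x
  B*-sub h (lam t)      = lam* (B*-sub under-lam t)
    where
      under-lam : ∀ x → B* (extsλ _ x) (extsλ _ x)
      under-lam zero    = ε
      under-lam (suc x) = gmap (renλ suc) (B-renλ suc) (h x)
  B*-sub h (app t s)    = appL* (B*-sub h t) ◅◅ appR* (B*-sub h s)
  B*-sub h (mu c)       = mu* (B*-subc (λ x → gmap wkμ (B-renμ suc) (h x)) c)
  B*-sub h ze           = ε
  B*-sub h (S t)        = S* (B*-sub h t)
  B*-sub h (nrec r s t) = nrec1* (B*-sub h r) ◅◅ (nrec2* (B*-sub h s) ◅◅ nrec3* (B*-sub h t))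

  B*-subc : ∀ {σ σ'} → (∀ x → B* (σ x) (σ' x)) → ∀ c → Bc* (subc σ c) (subc σ' c)
  B*-subc h (named α t) = named* (B*-sub h t)

data _→BE_ : Ctx → Ctx → Set where
  appE : ∀ {E E' t} → E →BE E' → appC E t →BE appC E' t
  appT : ∀ {E t t'} → t →B t' → appC E t →BE appC E t'
  SE   : ∀ {E E'} → E →BE E' → SC E →BE SC E'
  nr1  : ∀ {r r' s E} → r →B r' → nrecC r s E →BE nrecC r' s E
  nr2  : ∀ {r s s' E} → s →B s' → nrecC r s E →BE nrecC r s' E
  nr3  : ∀ {r s E E'} → E →BE E' → nrecC r s E →BE nrecC r s E'

plugBE : ∀ {E E'} → E →BE E' → ∀ q → plug E q →B plug E' q
plugBE (appE st) q = appξ₁ (plugBE st q)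
plugBE (appT st) q = appξ₂ st
plugBE (SE st)   q = Sξ (plugBE st q)
plugBE (nr1 st)  q = nrecξ₁ st
plugBE (nr2 st)  q = nrecξ₂ st
plugBE (nr3 st)  q = nrecξ₃ (plugBE st q)

renμBE : ∀ ρ {E E'} → E →BE E' → renμE ρ E →BE renμE ρ E'
renμBE ρ (appE st) = appE (renμBE ρ st)
renμBE ρ (appT st) = appT (B-renμ ρ st)
renμBE ρ (SE st)   = SE (renμBE ρ st)
renμBE ρ (nr1 st)  = nr1 (B-renμ ρ st)
renμBE ρ (nr2 st)  = nr2 (B-renμ ρ st)
renμBE ρ (nr3 st)  = nr3 (renμBE ρ st)

renλBE : ∀ ρ {E E'} → E →BE E' → renλE ρ E →BE renλE ρ E'
renλBE ρ (appE st) = appE (renλBE ρ st)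
renλBE ρ (appT st) = appT (B-renλ ρ st)
renλBE ρ (SE st)   = SE (renλBE ρ st)
renλBE ρ (nr1 st)  = nr1 (B-renλ ρ st)
renλBE ρ (nr2 st)  = nr2 (B-renλ ρ st)
renλBE ρ (nr3 st)  = nr3 (renλBE ρ st)

mutual
  ms-BE : ∀ {ρ κ κ'} → (∀ x → Star _→BE_ (κ x) (κ' x)) → ∀ t → B* (ms ρ κ t) (ms ρ κ' t)
  ms-BE h (var x)      = ε
  ms-BE h (lam t)      = lam* (ms-BE (λ x → gmap (renλE suc) (renλBE suc) (h x)) t)
  ms-BE h (app t s)    = appL* (ms-BE h t) ◅◅ appR* (ms-BE h s)
  ms-BE h (mu c)       = mu* (msc-BE under-mu c)
    where
      under-mu : ∀ x → Star _→BE_ (liftκ _ x) (liftκ _ x)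
      under-mu zero    = ε
      under-mu (suc x) = gmap (renμE suc) (renμBE suc) (h x)
  ms-BE h ze           = ε
  ms-BE h (S t)        = S* (ms-BE h t)
  ms-BE h (nrec r s t) = nrec1* (ms-BE h r) ◅◅ (nrec2* (ms-BE h s) ◅◅ nrec3* (ms-BE h t))

  msc-BE : ∀ {ρ κ κ'} → (∀ x → Star _→BE_ (κ x) (κ' x)) → ∀ c → Bc* (msc ρ κ c) (msc ρ κ' c)
  msc-BE {ρ} {κ} {κ'} h (named γ q) =
    named* (plug* (κ γ) (ms-BE h q) ◅◅ gmap (λ E → plug E (ms ρ κ' q)) (λ st → plugBE st _) (h γ))

-- Frames are the one-level evaluation contexts.  The three μ-rules of A
-- share one shape: a μ-abstraction in a frame F absorbs F,
--   F[μα.c] →A μα.c[α:=α F].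
data Frame : Ctx → Set where
  appF  : ∀ s → Frame (appC hole s)
  SF    : Frame (SC hole)
  nrecF : ∀ r s → Frame (nrecC r s hole)

frame-μ : ∀ {F} → Frame F → ∀ c → RootA (plug F (mu c)) (mu (ssc zero (renμE suc F) c))
frame-μ (appF s)    c = μapp c s
frame-μ SF          c = μS c
frame-μ (nrecF r s) c = nrecμ r s c

renμ-frame : ∀ ρ {F} → Frame F → Frame (renμE ρ F)
renμ-frame ρ (appF s)    = appF (renμ ρ s)
renμ-frame ρ SF          = SF
renμ-frame ρ (nrecF r s) = nrecF (renμ ρ r) (renμ ρ s)

renμ-ss0 : ∀ ρ E c → renμc (ext ρ) (ssc zero E c) ≡ ssc zero (renμE (ext ρ) E) (renμc (ext ρ) c)
renμ-ss0 ρ E c =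
  trans (cong (renμc (ext ρ)) (ssc-ms {ρ = λ x → x} (λ _ → refl) zero E c))
  (trans (renμc-ms (ext ρ) (λ x → x) (κss zero E) c)
  (trans (msc-ext (λ _ → refl) pointwise c)
  (trans (sym (msc-renμ (λ x → x) (κss zero (renμE (ext ρ) E)) (ext ρ) c))
         (sym (ssc-ms (λ _ → refl) zero _ (renμc (ext ρ) c))))))
  where
    pointwise : ∀ x → renμE (ext ρ) (κss zero E x) ≡ κss zero (renμE (ext ρ) E) (ext ρ x)
    pointwise zero    = refl
    pointwise (suc x) = refl

renμ-μss : ∀ ρ E c → renμ ρ (mu (ssc zero (renμE suc E) c))
                     ≡ mu (ssc zero (renμE suc (renμE ρ E)) (renμc (ext ρ) c))
renμ-μss ρ E c = cong mu (trans (renμ-ss0 ρ (renμE suc E) c)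
  (cong (λ F → ssc zero F (renμc (ext ρ) c))
        (trans (renμE-comp (ext ρ) suc E) (sym (renμE-comp suc ρ E)))))

A-renμ-frame : ∀ ρ {F} → Frame F → ∀ c →
               renμ ρ (plug F (mu c)) →A renμ ρ (mu (ssc zero (renμE suc F) c))
A-renμ-frame ρ {F} fr c =
  subst₂ _→A_ (sym (renμ-plug ρ F (mu c))) (sym (renμ-μss ρ F c)) (root (frame-μ (renμ-frame ρ fr) _))

A-renμ-root : ∀ ρ {t u} → RootA t u → renμ ρ t →A renμ ρ u
A-renμ-root ρ (β t r)       =
  subst (λ x → app (lam (renμ ρ t)) (renμ ρ r) →A x) (sym (renμ-sub1 ρ t r)) (root (β _ _))
A-renμ-root ρ (μS c)        = A-renμ-frame ρ SF c
A-renμ-root ρ (μapp c s)    = A-renμ-frame ρ (appF s) c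
A-renμ-root ρ (nrec0 r s)   = root (nrec0 _ _)
A-renμ-root ρ (nrecS r s n) =
  subst (λ x → nrec (renμ ρ r) (renμ ρ s) (S x) →A app (app (renμ ρ s) x) (nrec (renμ ρ r) (renμ ρ s) x))
        (sym (renμ-num ρ n)) (root (nrecS _ _ n))
A-renμ-root ρ (nrecμ r s c) = A-renμ-frame ρ (nrecF r s) c

mutual
  A-renμ : ∀ ρ {t u} → t →A u → renμ ρ t →A renμ ρ u
  A-renμ ρ (root r)     = A-renμ-root ρ r
  A-renμ ρ (lamξ st)    = lamξ (A-renμ ρ st)
  A-renμ ρ (appξ₁ st)   = appξ₁ (A-renμ ρ st)
  A-renμ ρ (appξ₂ st)   = appξ₂ (A-renμ ρ st)
  A-renμ ρ (muξ st)     = muξ (A-renμc (ext ρ) st)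
  A-renμ ρ (Sξ st)      = Sξ (A-renμ ρ st)
  A-renμ ρ (nrecξ₁ st)  = nrecξ₁ (A-renμ ρ st)
  A-renμ ρ (nrecξ₂ st)  = nrecξ₂ (A-renμ ρ st)
  A-renμ ρ (nrecξ₃ st)  = nrecξ₃ (A-renμ ρ st)

  A-renμc : ∀ ρ {c c'} → c →Ac c' → renμc ρ c →Ac renμc ρ c'
  A-renμc ρ (rootc ())
  A-renμc ρ (namedξ st) = namedξ (A-renμ ρ st)

-- Conversely, every A-step from a renamed term is the renaming of an
-- A-step (renamings create no redexes).  This is needed because a μβ-step
-- renames its body, and an A-step of the result must be traced back.
ReflectsA : (ℕ → ℕ) → Tm → Tm → Set
ReflectsA ρ q v = Σ Tm (λ q' → (q →A q') × (v ≡ renμ ρ q'))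

reflect-frame : ∀ ρ {F} → Frame F → ∀ c →
                ReflectsA ρ (plug F (mu c)) (mu (ssc zero (renμE suc (renμE ρ F)) (renμc (ext ρ) c)))
reflect-frame ρ fr c = _ , root (frame-μ fr c) , sym (renμ-μss ρ _ c)

reflect-nrecS : ∀ ρ x y w {W v} → W ≡ renμ ρ w → RootA (nrec (renμ ρ x) (renμ ρ y) (S W)) v →
                ReflectsA ρ (nrec x y (S w)) v
reflect-nrecS ρ x y w eq (nrecS _ _ n) with renμ-num⁻ ρ w n (sym eq)
... | refl = app (app y (num n)) (nrec x y (num n)) , root (nrecS x y n) ,
             cong (λ z → app (app (renμ ρ y) z) (nrec (renμ ρ x) (renμ ρ y) z)) (sym (renμ-num ρ n))

reflect-root : ∀ ρ q {v} → RootA (renμ ρ q) v → ReflectsA ρ q v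
reflect-root ρ (app (lam a) b)  (β _ _)         = a [0:= b ] , root (β a b) , sym (renμ-sub1 ρ a b)
reflect-root ρ (app (mu c) b)   (μapp _ _)      = reflect-frame ρ (appF b) c
reflect-root ρ (S (mu c))       (μS _)          = reflect-frame ρ SF c
reflect-root ρ (nrec x y ze)    (nrec0 _ _)     = x , root (nrec0 x y) , refl
reflect-root ρ (nrec x y (S w)) r               = reflect-nrecS ρ x y w refl r
reflect-root ρ (nrec x y (mu c)) (nrecμ _ _ _)  = reflect-frame ρ (nrecF x y) c

mutual
  reflect-A : ∀ ρ q {v} → renμ ρ q →A v → ReflectsA ρ q v
  reflect-A ρ (lam q) (lamξ st) with reflect-A ρ q st
  ... | q' , s , e = lam q' , lamξ s , cong lam e
  reflect-A ρ (app a b) (appξ₁ st) with reflect-A ρ a st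
  ... | q' , s , e = app q' b , appξ₁ s , cong (λ z → app z (renμ ρ b)) e
  reflect-A ρ (app a b) (appξ₂ st) with reflect-A ρ b st
  ... | q' , s , e = app a q' , appξ₂ s , cong (app (renμ ρ a)) e
  reflect-A ρ (mu c) (muξ st) with reflect-Ac (ext ρ) c st
  ... | c' , s , e = mu c' , muξ s , cong mu e
  reflect-A ρ (S a) (Sξ st) with reflect-A ρ a st
  ... | q' , s , e = S q' , Sξ s , cong S e
  reflect-A ρ (nrec a b d) (nrecξ₁ st) with reflect-A ρ a st
  ... | q' , s , e = nrec q' b d , nrecξ₁ s , cong (λ z → nrec z (renμ ρ b) (renμ ρ d)) e
  reflect-A ρ (nrec a b d) (nrecξ₂ st) with reflect-A ρ b st
  ... | q' , s , e = nrec a q' d , nrecξ₂ s , cong (λ z → nrec (renμ ρ a) z (renμ ρ d)) e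
  reflect-A ρ (nrec a b d) (nrecξ₃ st) with reflect-A ρ d st
  ... | q' , s , e = nrec a b q' , nrecξ₃ s , cong (nrec (renμ ρ a) (renμ ρ b)) e
  reflect-A ρ q (root r) = reflect-root ρ q r

  reflect-Ac : ∀ ρ c {v} → renμc ρ c →Ac v → Σ Cmd (λ c' → (c →Ac c') × (v ≡ renμc ρ c'))
  reflect-Ac ρ (named γ q) (namedξ st) with reflect-A ρ q st
  ... | q' , s , e = named γ q' , namedξ s , cong (named (ρ γ)) e
  reflect-Ac ρ (named γ q) (rootc ())

ss0-compose : ∀ F E c → ssc zero F (msc (λ x → x) (κss zero (renμE suc E)) c)
                        ≡ msc (λ x → x) (κss zero (F ∘E renμE suc E)) c
ss0-compose F E c =
  trans (ssc-ms {ρ = λ x → x} (λ _ → refl) zero F _)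
  (trans (msc-msc (λ x → x) (κss zero F) (λ x → x) (κss zero (renμE suc E)) c)
         (msc-ext (λ _ → refl) pointwise c))
  where
    pointwise : ∀ x → (((λ y → y) , κss zero F) ⊙κ ((λ y → y) , κss zero (renμE suc E))) x
                      ≡ κss zero (F ∘E renμE suc E) x
    pointwise zero    = cong (F ∘E_) (trans (msE-renμE (λ y → y) (κss zero F) suc E)
                                            (msE-ren (λ _ → refl) E))
    pointwise (suc x) = refl

absorb : Ctx → Cmd → Tm
absorb E c = mu (msc (λ x → x) (κss zero (renμE suc E)) c)

absorb-frame : ∀ {F} → Frame F → ∀ E c → plug F (absorb E c) →A absorb (F ∘E E) c
absorb-frame {F} fr E c =
  subst (λ z → plug F (absorb E c) →A mu z)
        (trans (ss0-compose (renμE suc F) E c) (cong (λ G → msc (λ x → x) (κss zero G) c)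
                                                         (sym (renμE-∘ suc F E))))
        (root (frame-μ fr _))

plug-μ : ∀ E c → A* (plug E (mu c)) (absorb E c)
plug-μ hole c =
  subst (λ z → A* (mu c) (mu z)) (sym (trans (msc-ren empty c) (renμc-id (λ _ → refl) c))) ε
  where
    empty : ∀ x → κss zero hole x ≡ hole
    empty zero    = refl
    empty (suc x) = refl
plug-μ (appC E b)    c = appL* (plug-μ E c) ◅◅ absorb-frame (appF b) E c ◅ ε
plug-μ (SC E)        c = S* (plug-μ E c) ◅◅ absorb-frame SF E c ◅ ε
plug-μ (nrecC r s E) c = nrec3* (plug-μ E c) ◅◅ absorb-frame (nrecF r s) E c ◅ ε

μβ-ms : ∀ ρ κ γ c →
  renμc (contract (ρ γ)) (msc (λ x → x) (κss zero (renμE suc (κ γ))) (msc (ext ρ) (liftκ κ) c))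
  ≡ msc ρ κ (renμc (contract γ) c)
μβ-ms ρ κ γ c =
  trans (cong (renμc (contract (ρ γ))) (msc-msc (λ x → x) inner (ext ρ) (liftκ κ) c))
  (trans (renμc-ms (contract (ρ γ)) (λ x → ext ρ x) _ c)
  (trans (msc-ext (contract-ext ρ γ) contexts c)
         (sym (msc-renμ ρ κ (contract γ) c))))
  where
    inner : ℕ → Ctx
    inner = κss zero (renμE suc (κ γ))
    unweaken : ∀ E → renμE (contract (ρ γ)) (renμE suc E) ≡ E
    unweaken E = trans (renμE-comp (contract (ρ γ)) suc E) (renμE-id (λ _ → refl) E)
    contexts : ∀ x → renμE (contract (ρ γ)) ((((λ y → y) , inner) ⊙κ (ext ρ , liftκ κ)) x)
                     ≡ κ (contract γ x)
    contexts zero    = trans (cong (renμE (contract (ρ γ))) (∘E-hole (renμE suc (κ γ))))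
                             (unweaken (κ γ))
    contexts (suc x) = trans (cong (renμE (contract (ρ γ)))
                               (trans (msE-renμE (λ y → y) inner suc (κ x)) (msE-ren (λ _ → refl) (κ x))))
                             (unweaken (κ x))

-- A B-step survives structural substitution, at the price of some
-- A-steps: a μβ-redex [γ]μβ.c becomes [ρ γ](κ γ)[μβ.c'], and the context
-- must first be absorbed by the μ (plug-μ) before μβ applies.
mutual
  ms-B : ∀ ρ κ {t u} → t →B u → AB* (ms ρ κ t) (ms ρ κ u)
  ms-B ρ κ (root (μη q)) =
    subst (λ z → AB* (mu (named zero z)) (ms ρ κ q)) weakened (B⇒AB (root (μη (ms ρ κ q))) ◅ ε)
    where
      weakened : wkμ (ms ρ κ q) ≡ ms (ext ρ) (liftκ κ) (wkμ q)
      weakened = trans (renμ-ms suc ρ κ q) (sym (ms-renμ (ext ρ) (liftκ κ) suc q))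
  ms-B ρ κ (lamξ st)   = lam* (ms-B ρ _ st)
  ms-B ρ κ (appξ₁ st)  = appL* (ms-B ρ κ st)
  ms-B ρ κ (appξ₂ st)  = appR* (ms-B ρ κ st)
  ms-B ρ κ (muξ st)    = mu* (msc-B (ext ρ) (liftκ κ) st)
  ms-B ρ κ (Sξ st)     = S* (ms-B ρ κ st)
  ms-B ρ κ (nrecξ₁ st) = nrec1* (ms-B ρ κ st)
  ms-B ρ κ (nrecξ₂ st) = nrec2* (ms-B ρ κ st)
  ms-B ρ κ (nrecξ₃ st) = nrec3* (ms-B ρ κ st)

  msc-B : ∀ ρ κ {c c'} → c →Bc c' → ABc* (msc ρ κ c) (msc ρ κ c')
  msc-B ρ κ (rootc (μβ γ c)) =
    named* (A*⇒AB* (plug-μ (κ γ) (msc (ext ρ) (liftκ κ) c))) ◅◅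
    subst (λ z → ABc* (named (ρ γ) (mu c₁)) z) (μβ-ms ρ κ γ c) (Bc⇒ABc (rootc (μβ (ρ γ) c₁)) ◅ ε)
    where
      c₁ : Cmd
      c₁ = msc (λ x → x) (κss zero (renμE suc (κ γ))) (msc (ext ρ) (liftκ κ) c)
  msc-B ρ κ (namedξ {α = γ} st) = named* (plug* (κ γ) (ms-B ρ κ st))

ss0-B : ∀ E {c c'} → c →Bc c' → ABc* (ssc zero E c) (ssc zero E c')
ss0-B E {c} {c'} st =
  subst₂ ABc* (sym (ssc-ms (λ _ → refl) zero E c)) (sym (ssc-ms (λ _ → refl) zero E c'))
         (msc-B (λ x → x) (κss zero E) st)

ss0-BE : ∀ {E E'} c → E →BE E' → Bc* (ssc zero E c) (ssc zero E' c)
ss0-BE {E} {E'} c st =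
  subst₂ Bc* (sym (ssc-ms (λ _ → refl) zero E c)) (sym (ssc-ms (λ _ → refl) zero E' c))
         (msc-BE {ρ = λ x → x} at-zero c)
  where
    at-zero : ∀ x → Star _→BE_ (κss zero E x) (κss zero E' x)
    at-zero zero    = st ◅ ε
    at-zero (suc x) = ε

ss0-wkμ : ∀ F q → ss zero F (wkμ q) ≡ wkμ q
ss0-wkμ F q = trans (ss-ms {ρ = λ x → x} (λ _ → refl) zero F (wkμ q))
                    (trans (ms-renμ (λ x → x) (κss zero F) suc q) (ms-ren (λ _ → refl) q))

Post : Tm → Tm → Set
Post t u = Σ Tm (λ t₂ → (t →A t₂) × AB* t₂ u)

Postc : Cmd → Cmd → Set
Postc c u = Σ Cmd (λ c₂ → (c →Ac c₂) × ABc* c₂ u)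

A*-Post : ∀ {a b u} → A* a b → Post b u → Post a u
A*-Post ε              p              = p
A*-Post (st ◅ steps) (_ , st₂ , rest) = _ , st , (A*⇒AB* steps ◅◅ A⇒AB st₂ ◅ rest)

-- A μη-redex in a frame followed by an A-step on the frame: let the
-- μ-rule absorb the frame first, then perform μη and the A-step.
frame-η : ∀ {F} → Frame F → ∀ q {u} → plug F q →A u → Post (plug F (mu (named zero (wkμ q)))) u
frame-η {F} fr q {u} e = _ , root (frame-μ fr _) ,
  subst (λ z → AB* (mu (named zero z)) u) plugged (B⇒AB (root (μη (plug F q))) ◅ A⇒AB e ◅ ε)
  where
    plugged : wkμ (plug F q) ≡ plug (renμE suc F) (ss zero (renμE suc F) (wkμ q))
    plugged = trans (renμ-plug suc F q) (cong (plug _) (sym (ss0-wkμ _ q)))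

frame-μB : ∀ {F} → Frame F → ∀ {c c'} → c →Bc c' → Post (plug F (mu c)) (mu (ssc zero (renμE suc F) c'))
frame-μB fr {c} d = _ , root (frame-μ fr c) , mu* (ss0-B _ d)

-- A term B-reducing to a numeral A-reduces to that numeral under a
-- vacuous μ; this handles nrec-redexes whose numeral was created by B.
numeral-B : ∀ k {x} → x →B num k → A* x (mu (named zero (wkμ (num k))))
numeral-B zero    (root (μη _)) = ε
numeral-B (suc k) (root (μη _)) = ε
numeral-B (suc k) (Sξ st)       = S* (numeral-B k st) ◅◅
  subst (λ z → S (mu (named zero (wkμ (num k)))) →A mu (named zero (S z)))
        (ss0-wkμ (SC hole) (num k)) (root (μS _)) ◅ ε

postpone-app₁ : ∀ {a a' b u} → a →B a' → RootA (app a' b) u → Post (app a b) u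
postpone-app₁ (root (μη q)) r              = frame-η (appF _) q (root r)
postpone-app₁ (lamξ {t = a} d) (β _ b)     = a [0:= b ] , root (β a b) , B⇒AB (B-sub (sub1 b) d) ◅ ε
postpone-app₁ (muξ d) (μapp _ b)           = frame-μB (appF b) d

postpone-app₂ : ∀ {a b b' u} → b →B b' → RootA (app a b') u → Post (app a b) u
postpone-app₂ {b = b} d (β a b')  = a [0:= b ] , root (β a b) , B*⇒AB* (B*-sub pointwise a)
  where
    pointwise : ∀ n → B* (sub1 b n) (sub1 b' n)
    pointwise zero    = d ◅ ε
    pointwise (suc n) = ε
postpone-app₂ d (μapp c b') = _ , root (μapp c _) , B*⇒AB* (mu* (ss0-BE c (appT (B-renμ suc d))))

postpone-S : ∀ {a a' u} → a →B a' → RootA (S a') u → Post (S a) u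
postpone-S (root (μη q)) r      = frame-η SF q (root r)
postpone-S (muξ d)       (μS _) = frame-μB SF d

postpone-nrec₃ : ∀ {r s x x' u} → x →B x' → RootA (nrec r s x') u → Post (nrec r s x) u
postpone-nrec₃ d (nrec0 r s)             =
  A*-Post (nrec3* (numeral-B zero d)) (frame-η (nrecF r s) ze (root (nrec0 r s)))
postpone-nrec₃ d (nrecS r s n)           =
  A*-Post (nrec3* (numeral-B (suc n) d)) (frame-η (nrecF r s) (num (suc n)) (root (nrecS r s n)))
postpone-nrec₃ (root (μη q)) (nrecμ r s c) = frame-η (nrecF r s) q (root (nrecμ r s c))
postpone-nrec₃ (muξ d)       (nrecμ r s c) = frame-μB (nrecF r s) d

postpone-nrec₁ : ∀ {r r' s x u} → r →B r' → RootA (nrec r' s x) u → Post (nrec r s x) u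
postpone-nrec₁ d (nrec0 _ s)   = _ , root (nrec0 _ s) , B⇒AB d ◅ ε
postpone-nrec₁ d (nrecS _ s n) = _ , root (nrecS _ s n) , B⇒AB (appξ₂ (nrecξ₁ d)) ◅ ε
postpone-nrec₁ d (nrecμ _ s c) = _ , root (nrecμ _ s c) , B*⇒AB* (mu* (ss0-BE c (nr1 (B-renμ suc d))))

postpone-nrec₂ : ∀ {r s s' x u} → s →B s' → RootA (nrec r s' x) u → Post (nrec r s x) u
postpone-nrec₂ d (nrec0 r _)   = _ , root (nrec0 r _) , ε
postpone-nrec₂ d (nrecS r _ n) =
  _ , root (nrecS r _ n) , B⇒AB (appξ₁ (appξ₁ d)) ◅ B⇒AB (appξ₂ (nrecξ₂ d)) ◅ ε
postpone-nrec₂ d (nrecμ r _ c) = _ , root (nrecμ r _ c) , B*⇒AB* (mu* (ss0-BE c (nr2 (B-renμ suc d))))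

inside : ∀ (f : Tm → Tm) → (∀ {a b} → a →A b → f a →A f b) → (∀ {a b} → AB* a b → AB* (f a) (f b)) →
         ∀ {t u} → Post t u → Post (f t) (f u)
inside f fA fAB (t₂ , st , rest) = f t₂ , fA st , fAB rest

commute : ∀ {t t₂ u} → t →A t₂ → t₂ →B u → Post t u
commute a b = _ , a , B⇒AB b ◅ ε

mutual
  postpone : ∀ {t t' u} → t →B t' → t' →A u → Post t u
  postpone (root (μη q)) e = _ , muξ (namedξ (A-renμ suc e)) , B⇒AB (root (μη _)) ◅ ε
  postpone (lamξ d)    (lamξ e)    = inside lam lamξ lam* (postpone d e)
  postpone (appξ₁ d)   (appξ₁ e)   = inside (λ z → app z _) appξ₁ appL* (postpone d e)
  postpone (appξ₁ d)   (appξ₂ e)   = commute (appξ₂ e) (appξ₁ d)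
  postpone (appξ₁ d)   (root r)    = postpone-app₁ d r
  postpone (appξ₂ d)   (appξ₁ e)   = commute (appξ₁ e) (appξ₂ d)
  postpone (appξ₂ d)   (appξ₂ e)   = inside (app _) appξ₂ appR* (postpone d e)
  postpone (appξ₂ d)   (root r)    = postpone-app₂ d r
  postpone (muξ d)     (muξ e)     with postponec d e
  ... | c₂ , st , rest = mu c₂ , muξ st , mu* rest
  postpone (Sξ d)      (Sξ e)      = inside S Sξ S* (postpone d e)
  postpone (Sξ d)      (root r)    = postpone-S d r
  postpone (nrecξ₁ d)  (nrecξ₁ e)  = inside (λ z → nrec z _ _) nrecξ₁ nrec1* (postpone d e)
  postpone (nrecξ₁ d)  (nrecξ₂ e)  = commute (nrecξ₂ e) (nrecξ₁ d)
  postpone (nrecξ₁ d)  (nrecξ₃ e)  = commute (nrecξ₃ e) (nrecξ₁ d)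
  postpone (nrecξ₁ d)  (root r)    = postpone-nrec₁ d r
  postpone (nrecξ₂ d)  (nrecξ₁ e)  = commute (nrecξ₁ e) (nrecξ₂ d)
  postpone (nrecξ₂ d)  (nrecξ₂ e)  = inside (λ z → nrec _ z _) nrecξ₂ nrec2* (postpone d e)
  postpone (nrecξ₂ d)  (nrecξ₃ e)  = commute (nrecξ₃ e) (nrecξ₂ d)
  postpone (nrecξ₂ d)  (root r)    = postpone-nrec₂ d r
  postpone (nrecξ₃ d)  (nrecξ₁ e)  = commute (nrecξ₁ e) (nrecξ₃ d)
  postpone (nrecξ₃ d)  (nrecξ₂ e)  = commute (nrecξ₂ e) (nrecξ₃ d)
  postpone (nrecξ₃ d)  (nrecξ₃ e)  = inside (nrec _ _) nrecξ₃ nrec3* (postpone d e)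
  postpone (nrecξ₃ d)  (root r)    = postpone-nrec₃ d r

  -- After a μβ-step the body is renamed, so the A-step is reflected back
  -- to the unrenamed body (reflect-A) and performed before μβ.
  postponec : ∀ {c c' u} → c →Bc c' → c' →Ac u → Postc c u
  postponec (rootc (μβ α (named γ q))) (namedξ e) with reflect-A (contract α) q e
  ... | q' , st , refl = named α (mu (named γ q')) , namedξ (muξ (namedξ st)) ,
                         Bc⇒ABc (rootc (μβ α (named γ q'))) ◅ ε
  postponec (namedξ d) (namedξ e) with postpone d e
  ... | t₂ , st , rest = named _ t₂ , namedξ st , named* rest

mutual
  size : Tm → ℕ
  size (var x)      = 1
  size (lam t)      = suc (size t)
  size (app t s)    = suc (size t + size s)
  size (mu c)       = suc (sizec c)
  size ze           = 1
  size (S t)        = suc (size t)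
  size (nrec r s t) = suc (size r + size s + size t)

  sizec : Cmd → ℕ
  sizec (named α t) = suc (size t)

mutual
  size-renμ : ∀ ρ t → size (renμ ρ t) ≡ size t
  size-renμ ρ (var x)      = refl
  size-renμ ρ (lam t)      = cong suc (size-renμ ρ t)
  size-renμ ρ (app t s)    = cong suc (cong₂ _+_ (size-renμ ρ t) (size-renμ ρ s))
  size-renμ ρ (mu c)       = cong suc (sizec-renμ (ext ρ) c)
  size-renμ ρ ze           = refl
  size-renμ ρ (S t)        = cong suc (size-renμ ρ t)
  size-renμ ρ (nrec r s t) =
    cong suc (cong₂ _+_ (cong₂ _+_ (size-renμ ρ r) (size-renμ ρ s)) (size-renμ ρ t))

  sizec-renμ : ∀ ρ c → sizec (renμc ρ c) ≡ sizec c
  sizec-renμ ρ (named α t) = cong suc (size-renμ ρ t)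

mutual
  B-size : ∀ {t u} → t →B u → size u < size t
  B-size (root (μη q)) =
    subst (λ z → size q < suc (suc z)) (sym (size-renμ suc q)) (s≤s (n≤1+n _))
  B-size (lamξ st)                   = s≤s (B-size st)
  B-size (appξ₁ {s = s} st)          = s≤s (+-monoˡ-< (size s) (B-size st))
  B-size (appξ₂ {t = t} st)          = s≤s (+-monoʳ-< (size t) (B-size st))
  B-size (muξ st)                    = s≤s (B-sizec st)
  B-size (Sξ st)                     = s≤s (B-size st)
  B-size (nrecξ₁ {s = s} {t} st)     = s≤s (+-monoˡ-< (size t) (+-monoˡ-< (size s) (B-size st)))
  B-size (nrecξ₂ {r = r} {t = t} st) = s≤s (+-monoˡ-< (size t) (+-monoʳ-< (size r) (B-size st)))
  B-size (nrecξ₃ {r = r} {s} st)     = s≤s (+-monoʳ-< (size r + size s) (B-size st))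

  B-sizec : ∀ {c c'} → c →Bc c' → sizec c' < sizec c
  B-sizec (rootc (μβ α c)) =
    subst (λ z → z < suc (suc (sizec c))) (sym (sizec-renμ (contract α) c)) (s≤s (n≤1+n _))
  B-sizec (namedξ st) = s≤s (B-size st)

SN-measure : ∀ {R : Tm → Tm → Set} (m : Tm → ℕ) → (∀ {t u} → R t u → m u < m t) → ∀ t → SN R t
SN-measure {R} m decreasing t = go t (<-wellFounded (m t))
  where
    go : ∀ t → Acc _<_ (m t) → SN R t
    go t (acc smaller) = sn (λ u st → go u (smaller (decreasing st)))

SN-Star : ∀ {R : Tm → Tm → Set} {t u} → SN R t → Star R t u → SN R u
SN-Star h            ε            = h
SN-Star (sn steps) (st ◅ rest) = SN-Star (steps _ st) rest

module Postponement
  {R B RB : Tm → Tm → Set}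
  (split : ∀ {t u} → RB t u → R t u ⊎ B t u)
  (B-SN : ∀ t → SN B t)
  (postpone-step : ∀ {t t' u} → B t t' → R t' u → Σ Tm (λ t₂ → R t t₂ × Star RB t₂ u))
  where

  postpone-steps : ∀ {t t' u} → Star B t t' → R t' u → Σ Tm (λ t₂ → R t t₂ × Star RB t₂ u)
  postpone-steps ε            r = _ , r , ε
  postpone-steps (b ◅ bs) r with postpone-steps bs r
  ... | t₃ , r₃ , rest₃ with postpone-step b r₃
  ... | t₂ , r₂ , rest₂ = t₂ , r₂ , (rest₂ ◅◅ rest₃)

  -- Outer induction on SN_R t, inner induction on SN_B t' for the
  -- B-reducts t' of t.  An R-step from t' is postponed to an R-step from
  -- t, where the outer hypothesis applies; a B-step stays inside SN_B.
  SN-B-reducts : ∀ t → SN R t → ∀ t' → Star B t t' → SN B t' → SN RB t'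
  SN-B-reducts t (sn R-steps) = inner
    where
      inner : ∀ t' → Star B t t' → SN B t' → SN RB t'
      inner t' bs (sn B-steps) = sn (λ u st → [ by-R , by-B u ] (split st))
        where
          by-R : ∀ {u} → R t' u → SN RB u
          by-R r = let (t₂ , r₂ , rest) = postpone-steps bs r in
                   SN-Star (SN-B-reducts t₂ (R-steps t₂ r₂) t₂ ε (B-SN t₂)) rest
          by-B : ∀ u → B t' u → SN RB u
          by-B u b = inner u (bs ◅◅ b ◅ ε) (B-steps u b)

  SN-postponement : ∀ t → SN R t → SN RB t
  SN-postponement t h = SN-B-reducts t h t ε (B-SN t)

lemma6p33 : (t : Tm) → SN _→A_ t → SN _→AB_ t
lemma6p33 = SN-postponement
  where
    open Postponement splitAB (SN-measure size B-size) postpone
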